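{- Let $q$ be the square of a prime power, fix $\beta\in\mathbb{F}_{q^2}\setminus\mathbb{F}_q$ and a primitive element $\varepsilon$ of $\mathbb{F}_q$, let $Q=\{\gamma\in\mathbb{F}_q^*:\gamma^{\sqrt{q}+1}=1\}$, $X_q=\operatorname{Cay}\big(\mathbb{F}_{q^2}^+,\bigcup_{\delta\in Q}(\delta+\beta)\mathbb{F}_q^*\big)$ and $C_q=\{\gamma^{\sqrt{q}}+\gamma\beta:\gamma\in\mathbb{F}_q\}$. Then for every $i\in\{0,1,\ldots,\sqrt{q}\}$ the set $\varepsilon^iC_q$ is a non-canonical clique of $X_q$, and for all $i\ne j$ in $\{0,1,\ldots,\sqrt{q}\}$ we have $\varepsilon^iC_q\cap\varepsilon^jC_q=\{0\}$.
   Context: For an abelian group $G$ and $S\subseteq G\setminus\{0\}$ with $S=-S$, $\operatorname{Cay}(G,S)$ is the graph on $G$ with $g\sim h$ iff $g-h\in S$. $X_q$ has clique number $q$; maximum cliques have size $q$. Its canonical cliques are the sets $x+(\delta+\beta)\mathbb{F}_q$ with $x\in\mathbb{F}_{q^2}$, $\delta\in Q$; a non-canonical clique is a maximum clique that is not canonical. -}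

module Defs where

open import Level using (Level; _⊔_)
open import Data.Nat as ℕ using (ℕ; zero; suc; _∸_; _≤_)
  renaming (_+_ to _+ℕ_; _*_ to _*ℕ_; _^_ to _^ℕ_)
open import Data.Nat.Primality using (Prime)
open import Data.Fin using (Fin)
open import Data.Product using (Σ; ∃; _×_; _,_)
open import Relation.Nullary using (¬_)
open import Relation.Binary.PropositionalEquality using (_≡_)
open import Algebra.Bundles using (CommutativeRing)

IsSqPrimePower : ℕ → ℕ → Set
IsSqPrimePower q r = Σ ℕ λ p → Σ ℕ λ m → Prime p × 1 ≤ m × r ≡ p ^ℕ m × q ≡ r *ℕ r

module _ {c ℓ : Level} (R : CommutativeRing c ℓ) where
  open CommutativeRing R

  pow : Carrier → ℕ → Carrier
  pow x zero    = 1#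
  pow x (suc n) = x * pow x n

  IsField : Set (c ⊔ ℓ)
  IsField = ¬ (1# ≈ 0#) × (∀ x → ¬ (x ≈ 0#) → ∃ λ y → x * y ≈ 1#)

  HasSize : (Carrier → Set (c ⊔ ℓ)) → ℕ → Set (c ⊔ ℓ)
  HasSize P n = Σ (Fin n → Carrier) λ f →
      (∀ i → P (f i))
    × (∀ i j → f i ≈ f j → i ≡ j)
    × (∀ y → P y → ∃ λ i → y ≈ f i)

  HasCard : ℕ → Set (c ⊔ ℓ)
  HasCard n = HasSize (λ _ → Lift⊤) n
    where open import Data.Unit.Polymorphic using () renaming (⊤ to Lift⊤)

  CayAdj : (Carrier → Set (c ⊔ ℓ)) → Carrier → Carrier → Set (c ⊔ ℓ)
  CayAdj S g h = S (g - h)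

  IsClique : (Carrier → Carrier → Set (c ⊔ ℓ)) → (Carrier → Set (c ⊔ ℓ)) → Set (c ⊔ ℓ)
  IsClique Adj C = ∀ g h → C g → C h → ¬ (g ≈ h) → Adj g h

  module Setup (q r : ℕ) (β : Carrier) where

    -- the subfield 𝔽_q of 𝔽_{q²}: fixed points of x ↦ x^q
    Fq : Carrier → Set (c ⊔ ℓ)
    Fq x = Level.Lift (c ⊔ ℓ) (pow x q ≈ x)

    Fq* : Carrier → Set (c ⊔ ℓ)
    Fq* x = Fq x × ¬ (x ≈ 0#)

    IsPrimitive : Carrier → Set (c ⊔ ℓ)
    IsPrimitive ε = Fq* ε × (∀ x → Fq* x → ∃ λ i → x ≈ pow ε i)

    Qset : Carrier → Set (c ⊔ ℓ)
    Qset γ = Fq* γ × pow γ (suc r) ≈ 1#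

    Sset : Carrier → Set (c ⊔ ℓ)
    Sset x = ∃ λ δ → ∃ λ t → Qset δ × Fq* t × x ≈ (δ + β) * t

    Xadj : Carrier → Carrier → Set (c ⊔ ℓ)
    Xadj = CayAdj Sset

    -- maximum clique of X_q (clique number of X_q is q)
    IsMaxClique : (Carrier → Set (c ⊔ ℓ)) → Set (c ⊔ ℓ)
    IsMaxClique C = IsClique Xadj C × HasSize C q

    IsCanonical : (Carrier → Set (c ⊔ ℓ)) → Set (c ⊔ ℓ)
    IsCanonical C = ∃ λ x → ∃ λ δ → Qset δ ×
      (∀ y → (C y → ∃ λ t → Fq t × y ≈ x + (δ + β) * t)
           × ((∃ λ t → Fq t × y ≈ x + (δ + β) * t) → C y))

    IsNonCanonicalClique : (Carrier → Set (c ⊔ ℓ)) → Set (c ⊔ ℓ)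
    IsNonCanonicalClique C = IsMaxClique C × ¬ IsCanonical C

    epsCq : Carrier → ℕ → Carrier → Set (c ⊔ ℓ)
    epsCq ε i y = ∃ λ γ → Fq γ × y ≈ pow ε i * (pow γ r + γ * β)

-- Write r = √q. In characteristic p the map x ↦ x^r is additive, so the fixed points 𝔽_q of
-- x ↦ x^q form a subfield; as x^(q²) = x and β ∉ 𝔽_q, every element of L is uniquely a + bβ with
-- a, b ∈ 𝔽_q. The point εⁱ(γ^r + γβ) of εⁱC_q has coordinates (εⁱγ^r, εⁱγ). Two points of εⁱC_q
-- differ by (γ^(r-1) + β)·εⁱγ with 0 ≠ γ ∈ 𝔽_q and (γ^(r-1))^(r+1) = γ^(q-1) = 1, so εⁱC_q is a
-- clique, and it has q points because εⁱγ determines γ. If εⁱC_q were x + (δ + β)𝔽_q, comparing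
-- coordinates would give γ^r = δγ on 𝔽_q, hence ε^(r-1) = 1; a common nonzero point of εⁱC_q and
-- εʲC_q would give ε^(i(r-1)) = ε^(j(r-1)). Both contradict the order q - 1 of ε, which follows by
-- counting L as pairs of coordinates.
module Submission where

open import Level using (Level; _⊔_; lift; lower)
open import Algebra.Bundles using (CommutativeRing; CommutativeMonoid)
open import Algebra.Solver.Ring.AlmostCommutativeRing using (fromCommutativeRing; _-Raw-AlmostCommutative⟶_)
import Algebra.Solver.Ring
import Algebra.Properties.CommutativeMonoid.Sum as CommutativeMonoidSum
open import Data.Nat as ℕ using (ℕ; zero; suc; _∸_; _<_; _≤_; z≤n; s≤s; NonZero; _!)
import Data.Nat.Properties as ℕₚ
open import Data.Nat.Divisibility using (_∣_; divides; ∣⇒≤; ∣1⇒≡1; m∣m*n)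
open import Data.Nat.DivMod using (_%_; _/_; m/n*n≡m; m≡m%n+[m/n]*n; m%n<n)
open import Data.Nat.Primality using (Prime; euclidsLemma; ¬prime[1]; prime⇒nonZero; prime⇒nonTrivial)
open import Data.Nat.Combinatorics using (_C_; nCn≡1; k![n∸k]!∣n!)
open import Data.Nat.Combinatorics.Specification using (nCk≡n!/k![n-k]!)
open import Data.Integer as ℤ using (ℤ; +_; -[1+_]; _⊖_; sign; ∣_∣; _◃_)
import Data.Integer.Properties as ℤₚ
open import Data.Sign as Sign using (Sign)
open import Data.Fin as Fin using (Fin; zero; suc; toℕ; inject₁; fromℕ; fromℕ<; punchIn; combine)
import Data.Fin.Properties as Finₚ
open import Data.Fin.Permutation using (permutation)
open import Data.Maybe using (Maybe; just; nothing)
open import Data.Sum using (inj₁; inj₂)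
open import Data.Product using (Σ; ∃; _×_; _,_; proj₁; proj₂; uncurry)
open import Data.Product.Properties using (×-≡,≡→≡)
open import Data.Empty using (⊥-elim)
open import Relation.Nullary using (¬_; yes; no)
open import Relation.Binary using (Decidable; tri<; tri≈; tri>)
open import Relation.Binary.PropositionalEquality as ≡ using (_≡_; _≢_)
open import Defs

-- With integer coefficients the solver sees cancellations such as x - x ≈ 0#, which it cannot
-- decide when the coefficients are elements of an arbitrary ring.
module IntegerCoefficientSolver {c ℓ : Level} (R : CommutativeRing c ℓ) where
  open CommutativeRing R
  open import Algebra.Properties.Ring ring
    using (-0#≈0#; -‿involutive; -1*x≈-x; -‿+-comm)
  open import Algebra.Properties.CommutativeSemigroup *-commutativeSemigroup using (interchange)
  open import Algebra.Properties.Semiring.Mult semiring using (×-homo-+; ×1-homo-*) renaming (_×_ to _·_)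
  open import Relation.Binary.Reasoning.Setoid setoid

  private
    ⟦_⟧ : ℤ → Carrier
    ⟦ + n ⟧      = n · 1#
    ⟦ -[1+ n ] ⟧ = - (suc n · 1#)

    sgn : Sign → Carrier
    sgn Sign.+ = 1#
    sgn Sign.- = - 1#

    ⊖-homo : ∀ m n → ⟦ m ⊖ n ⟧ ≈ m · 1# - n · 1#
    ⊖-homo m       zero    = sym (trans (+-congˡ -0#≈0#) (+-identityʳ _))
    ⊖-homo zero    (suc n) = sym (+-identityˡ _)
    ⊖-homo (suc m) (suc n) = begin
      ⟦ suc m ⊖ suc n ⟧               ≡⟨ ≡.cong ⟦_⟧ (ℤₚ.[1+m]⊖[1+n]≡m⊖n m n) ⟩
      ⟦ m ⊖ n ⟧                       ≈⟨ ⊖-homo m n ⟩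
      m · 1# - n · 1#                 ≈⟨ [1+a]-[1+b]≈a-b (m · 1#) (n · 1#) ⟨
      suc m · 1# - suc n · 1#         ∎
      where
      [1+a]-[1+b]≈a-b : ∀ a b → (1# + a) - (1# + b) ≈ a - b
      [1+a]-[1+b]≈a-b a b = begin
        (1# + a) + - (1# + b)   ≈⟨ +-congˡ (-‿+-comm 1# b) ⟨
        (1# + a) + (- 1# + - b) ≈⟨ +-congʳ (+-comm 1# a) ⟩
        (a + 1#) + (- 1# + - b) ≈⟨ +-assoc a 1# _ ⟩
        a + (1# + (- 1# + - b)) ≈⟨ +-congˡ (+-assoc 1# (- 1#) (- b)) ⟨
        a + ((1# - 1#) + - b)   ≈⟨ +-congˡ (+-congʳ (-‿inverseʳ 1#)) ⟩
        a + (0# + - b)          ≈⟨ +-congˡ (+-identityˡ (- b)) ⟩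
        a - b                   ∎

    ◃-homo : ∀ s n → ⟦ s ◃ n ⟧ ≈ sgn s * (n · 1#)
    ◃-homo s       zero    = sym (zeroʳ _)
    ◃-homo Sign.+ (suc n)  = sym (*-identityˡ _)
    ◃-homo Sign.- (suc n)  = sym (-1*x≈-x _)

    sign-abs : ∀ i → ⟦ i ⟧ ≈ sgn (sign i) * (∣ i ∣ · 1#)
    sign-abs (+ n)      = sym (*-identityˡ _)
    sign-abs -[1+ n ]   = sym (-1*x≈-x _)

    sgn-homo : ∀ s t → sgn (s Sign.* t) ≈ sgn s * sgn t
    sgn-homo Sign.+ t      = sym (*-identityˡ _)
    sgn-homo Sign.- Sign.+ = sym (*-identityʳ _)
    sgn-homo Sign.- Sign.- = sym (trans (-1*x≈-x (- 1#)) (-‿involutive 1#))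

    +-homo : ∀ i j → ⟦ i ℤ.+ j ⟧ ≈ ⟦ i ⟧ + ⟦ j ⟧
    +-homo (+ m)    (+ n)    = ×-homo-+ 1# m n
    +-homo (+ m)    -[1+ n ] = ⊖-homo m (suc n)
    +-homo -[1+ m ] (+ n)    = trans (⊖-homo n (suc m)) (+-comm _ _)
    +-homo -[1+ m ] -[1+ n ] = begin
      - (suc (suc (m ℕ.+ n)) · 1#)         ≡⟨ ≡.cong (λ k → - (k · 1#)) (ℕₚ.+-suc (suc m) n) ⟨
      - ((suc m ℕ.+ suc n) · 1#)           ≈⟨ -‿cong (×-homo-+ 1# (suc m) (suc n)) ⟩
      - (suc m · 1# + suc n · 1#)          ≈⟨ -‿+-comm _ _ ⟨
      - (suc m · 1#) + - (suc n · 1#)      ∎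

    *-homo : ∀ i j → ⟦ i ℤ.* j ⟧ ≈ ⟦ i ⟧ * ⟦ j ⟧
    *-homo i j = begin
      ⟦ (sign i Sign.* sign j) ◃ (∣ i ∣ ℕ.* ∣ j ∣) ⟧
        ≈⟨ ◃-homo (sign i Sign.* sign j) (∣ i ∣ ℕ.* ∣ j ∣) ⟩
      sgn (sign i Sign.* sign j) * ((∣ i ∣ ℕ.* ∣ j ∣) · 1#)
        ≈⟨ *-cong (sgn-homo (sign i) (sign j)) (×1-homo-* ∣ i ∣ ∣ j ∣) ⟩
      (sgn (sign i) * sgn (sign j)) * ((∣ i ∣ · 1#) * (∣ j ∣ · 1#))
        ≈⟨ interchange _ _ _ _ ⟩
      (sgn (sign i) * (∣ i ∣ · 1#)) * (sgn (sign j) * (∣ j ∣ · 1#))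
        ≈⟨ *-cong (sign-abs i) (sign-abs j) ⟨
      ⟦ i ⟧ * ⟦ j ⟧ ∎

    neg-homo : ∀ i → ⟦ ℤ.- i ⟧ ≈ - ⟦ i ⟧
    neg-homo (+ zero)   = sym -0#≈0#
    neg-homo (+ suc n)  = refl
    neg-homo -[1+ n ]   = sym (-‿involutive _)

    homomorphism : ℤ.+-*-rawRing -Raw-AlmostCommutative⟶ fromCommutativeRing R
    homomorphism = record
      { ⟦_⟧    = ⟦_⟧
      ; +-homo = +-homo
      ; *-homo = *-homo
      ; -‿homo = neg-homo
      ; 0-homo = refl
      ; 1-homo = +-identityʳ 1#
      }

    ≟-coefficients : ∀ i j → Maybe (⟦ i ⟧ ≈ ⟦ j ⟧)
    ≟-coefficients i j with i ℤ.≟ j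
    ... | yes ≡.refl = just refl
    ... | no _       = nothing

  open Algebra.Solver.Ring ℤ.+-*-rawRing (fromCommutativeRing R) homomorphism ≟-coefficients public

prime∤! : ∀ {p} → Prime p → ∀ j → j < p → ¬ p ∣ j !
prime∤! p-prime zero    _   p∣1 = ¬prime[1] (≡.subst Prime (∣1⇒≡1 p∣1) p-prime)
prime∤! p-prime (suc j) j<p p∣j! with euclidsLemma (suc j) (j !) p-prime p∣j!
... | inj₁ p∣1+j = ℕₚ.<⇒≱ j<p (∣⇒≤ p∣1+j)
... | inj₂ p∣j!  = prime∤! p-prime j (ℕₚ.<-trans (ℕₚ.n<1+n j) j<p) p∣j!

nCk*k![n∸k]!≡n! : ∀ {n k} → k ≤ n → (n C k) ℕ.* (k ! ℕ.* (n ∸ k) !) ≡ n !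
nCk*k![n∸k]!≡n! {n} {k} k≤n = ≡.trans (≡.cong (ℕ._* (k ! ℕ.* (n ∸ k) !)) (nCk≡n!/k![n-k]! k≤n))
                                      (m/n*n≡m (k![n∸k]!∣n! k≤n))
  where instance _ = k ℕₚ.!* (n ∸ k) !≢0

prime∣pCk : ∀ {p k} → Prime p → 0 < k → k < p → p ∣ p C k
prime∣pCk {p@(suc p-1)} {k} p-prime 0<k k<p
  with euclidsLemma (p C k) (k ! ℕ.* (p ∸ k) !) p-prime
         (≡.subst (p ∣_) (≡.sym (nCk*k![n∸k]!≡n! (ℕₚ.<⇒≤ k<p))) (m∣m*n (p-1 !)))
... | inj₁ p∣pCk = p∣pCk
... | inj₂ p∣k![p∸k]! with euclidsLemma (k !) ((p ∸ k) !) p-prime p∣k![p∸k]!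
...   | inj₁ p∣k!     = ⊥-elim (prime∤! p-prime k k<p p∣k!)
...   | inj₂ p∣[p∸k]! = ⊥-elim (prime∤! p-prime (p ∸ k) (ℕₚ.∸-monoʳ-< 0<k (ℕₚ.<⇒≤ k<p)) p∣[p∸k]!)

module Powers {c ℓ : Level} (R : CommutativeRing c ℓ) where
  open CommutativeRing R hiding (zero)
  open import Algebra.Properties.Semiring.Exp semiring as Exp using () renaming (_^_ to _^ᴹ_)
  open import Algebra.Properties.CommutativeSemiring.Exp commutativeSemiring as CExp using ()
  open import Algebra.Properties.Semiring.Mult semiring using (×-assoc-*) renaming (_×_ to _·_)
  open import Algebra.Properties.AbelianGroup +-abelianGroup using (inverseʳ-unique)
  open IntegerCoefficientSolver R
  open import Relation.Binary.Reasoning.Setoid setoid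

  infixr 8 _^_
  _^_ : Carrier → ℕ → Carrier
  x ^ n = pow R x n

  ^≈^ᴹ : ∀ x n → x ^ n ≈ x ^ᴹ n
  ^≈^ᴹ x zero    = refl
  ^≈^ᴹ x (suc n) = *-congˡ (^≈^ᴹ x n)

  ^-congˡ : ∀ n {x y} → x ≈ y → x ^ n ≈ y ^ n
  ^-congˡ zero    x≈y = refl
  ^-congˡ (suc n) x≈y = *-cong x≈y (^-congˡ n x≈y)

  ^-congʳ : ∀ x {m n} → m ≡ n → x ^ m ≈ x ^ n
  ^-congʳ x ≡.refl = refl

  ^-homo-* : ∀ x m n → x ^ (m ℕ.+ n) ≈ x ^ m * x ^ n
  ^-homo-* x zero    n = sym (*-identityˡ _)
  ^-homo-* x (suc m) n = trans (*-congˡ (^-homo-* x m n)) (sym (*-assoc _ _ _))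

  ^-distrib-* : ∀ x y n → (x * y) ^ n ≈ x ^ n * y ^ n
  ^-distrib-* x y n = begin
    (x * y) ^ n         ≈⟨ ^≈^ᴹ (x * y) n ⟩
    (x * y) ^ᴹ n        ≈⟨ CExp.^-distrib-* x y n ⟩
    x ^ᴹ n * y ^ᴹ n     ≈⟨ *-cong (^≈^ᴹ x n) (^≈^ᴹ y n) ⟨
    x ^ n * y ^ n       ∎

  ^-assocʳ : ∀ x m n → (x ^ m) ^ n ≈ x ^ (m ℕ.* n)
  ^-assocʳ x m n = begin
    (x ^ m) ^ n         ≈⟨ ^≈^ᴹ (x ^ m) n ⟩
    (x ^ m) ^ᴹ n        ≈⟨ Exp.^-congˡ n (^≈^ᴹ x m) ⟩
    (x ^ᴹ m) ^ᴹ n       ≈⟨ Exp.^-assocʳ x m n ⟩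
    x ^ᴹ (m ℕ.* n)      ≈⟨ ^≈^ᴹ x (m ℕ.* n) ⟨
    x ^ (m ℕ.* n)       ∎

  1^n≈1 : ∀ n → 1# ^ n ≈ 1#
  1^n≈1 zero    = refl
  1^n≈1 (suc n) = trans (*-identityˡ _) (1^n≈1 n)

  ^-reduce-% : ∀ {x} k .{{_ : NonZero k}} → x ^ k ≈ 1# → ∀ n → x ^ n ≈ x ^ (n % k)
  ^-reduce-% {x} k xᵏ≈1 n = begin
    x ^ n                                 ≈⟨ ^-congʳ x (m≡m%n+[m/n]*n n k) ⟩
    x ^ (n % k ℕ.+ (n / k) ℕ.* k)         ≈⟨ ^-homo-* x (n % k) _ ⟩
    x ^ (n % k) * x ^ ((n / k) ℕ.* k)     ≈⟨ *-congˡ (^-congʳ x (ℕₚ.*-comm (n / k) k)) ⟩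
    x ^ (n % k) * x ^ (k ℕ.* (n / k))     ≈⟨ *-congˡ (^-assocʳ x k (n / k)) ⟨
    x ^ (n % k) * (x ^ k) ^ (n / k)       ≈⟨ *-congˡ (^-congˡ (n / k) xᵏ≈1) ⟩
    x ^ (n % k) * 1# ^ (n / k)            ≈⟨ *-congˡ (1^n≈1 (n / k)) ⟩
    x ^ (n % k) * 1#                      ≈⟨ *-identityʳ _ ⟩
    x ^ (n % k)                           ∎

  Additive : ℕ → Set (c ⊔ ℓ)
  Additive n = ∀ x y → (x + y) ^ n ≈ x ^ n + y ^ n

  additive-1 : Additive 1
  additive-1 x y = trans (*-identityʳ _) (sym (+-cong (*-identityʳ x) (*-identityʳ y)))

  additive-* : ∀ {m n} → Additive m → Additive n → Additive (m ℕ.* n)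
  additive-* {m} {n} m-additive n-additive x y = begin
    (x + y) ^ (m ℕ.* n)               ≈⟨ ^-assocʳ (x + y) m n ⟨
    ((x + y) ^ m) ^ n                 ≈⟨ ^-congˡ n (m-additive x y) ⟩
    (x ^ m + y ^ m) ^ n               ≈⟨ n-additive _ _ ⟩
    (x ^ m) ^ n + (y ^ m) ^ n         ≈⟨ +-cong (^-assocʳ x m n) (^-assocʳ y m n) ⟩
    x ^ (m ℕ.* n) + y ^ (m ℕ.* n)     ∎

  module _ {n} (n-additive : Additive n) where

    additive-0# : 0# ^ n ≈ 0#
    additive-0# = begin
      0# ^ n                        ≈⟨ solve 1 (λ z → z := (z :+ z) :- z) refl (0# ^ n) ⟩
      (0# ^ n + 0# ^ n) - 0# ^ n    ≈⟨ +-congʳ (n-additive 0# 0#) ⟨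
      (0# + 0#) ^ n - 0# ^ n        ≈⟨ +-congʳ (^-congˡ n (+-identityʳ 0#)) ⟩
      0# ^ n - 0# ^ n               ≈⟨ -‿inverseʳ _ ⟩
      0#                            ∎

    additive-neg : ∀ x → (- x) ^ n ≈ - (x ^ n)
    additive-neg x = inverseʳ-unique (x ^ n) ((- x) ^ n) (begin
      x ^ n + (- x) ^ n    ≈⟨ n-additive x (- x) ⟨
      (x - x) ^ n          ≈⟨ ^-congˡ n (-‿inverseʳ x) ⟩
      0# ^ n               ≈⟨ additive-0# ⟩
      0#                   ∎)

    additive-sub : ∀ x y → (x - y) ^ n ≈ x ^ n - y ^ n
    additive-sub x y = trans (n-additive x (- y)) (+-congˡ (additive-neg y))

  pCk·z≈0 : ∀ {p k} → Prime p → p · 1# ≈ 0# → ∀ z → 0 < k → k < p → (p C k) · z ≈ 0#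
  pCk·z≈0 {p} {k} p-prime p·1≈0 z 0<k k<p with prime∣pCk p-prime 0<k k<p
  ... | divides d pCk≡d*p = begin
    (p C k) · z     ≡⟨ ≡.cong (_· z) pCk≡d*p ⟩
    (d ℕ.* p) · z   ≈⟨ ×-assocˡ z d p ⟨
    d · (p · z)     ≈⟨ ×-congʳ d p·z≈0 ⟩
    d · 0#          ≈⟨ ·0≈0 d ⟩
    0#              ∎
    where
    open import Algebra.Properties.Semiring.Mult semiring using (×-assocˡ; ×-congʳ)
    p·z≈0 : p · z ≈ 0#
    p·z≈0 = begin
      p · z           ≈⟨ ×-congʳ p (*-identityˡ z) ⟨
      p · (1# * z)    ≈⟨ ×-assoc-* p 1# z ⟨
      (p · 1#) * z    ≈⟨ *-congʳ p·1≈0 ⟩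
      0# * z          ≈⟨ zeroˡ z ⟩
      0#              ∎
    ·0≈0 : ∀ d → d · 0# ≈ 0#
    ·0≈0 zero    = refl
    ·0≈0 (suc d) = trans (+-identityˡ _) (·0≈0 d)

  additive-prime : ∀ {p} → Prime p → p · 1# ≈ 0# → Additive p
  additive-prime {p@(suc p-1)} p-prime p·1≈0 x y = begin
    (x + y) ^ p                                   ≈⟨ ^≈^ᴹ (x + y) p ⟩
    (x + y) ^ᴹ p                                  ≈⟨ theorem p x y ⟩
    term zero + sum (λ k → term (suc k))          ≈⟨ +-congˡ (sum-init-last (λ k → term (suc k))) ⟩
    term zero + (sum middle + term (suc (fromℕ p-1)))
                                                  ≈⟨ +-congˡ (+-congʳ middle≈0) ⟩
    term zero + (0# + term (suc (fromℕ p-1)))     ≈⟨ +-congˡ (+-identityˡ _) ⟩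
    term zero + term (suc (fromℕ p-1))            ≈⟨ +-comm _ _ ⟩
    term (suc (fromℕ p-1)) + term zero            ≈⟨ +-cong last≈xᵖ first≈yᵖ ⟩
    x ^ p + y ^ p                                 ∎
    where
    open import Algebra.Properties.CommutativeSemiring.Binomial commutativeSemiring
      using (theorem; binomialTerm)
    open import Algebra.Properties.Semiring.Sum semiring using (sum; sum-init-last; sum-cong-≋; sum-replicate-zero)
    open import Algebra.Properties.Semiring.Mult semiring using (×-homo-1; ×-cong)

    term : Fin (suc p) → Carrier
    term = binomialTerm x y p

    middle : Fin p-1 → Carrier
    middle k = term (suc (inject₁ k))

    middle≈0 : sum middle ≈ 0#
    middle≈0 = trans (sum-cong-≋ {p-1} λ k → pCk·z≈0 p-prime p·1≈0 _ (s≤s z≤n) (s≤s (k<p-1 k)))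
                     (sum-replicate-zero p-1)
      where
      k<p-1 : ∀ k → toℕ (inject₁ k) < p-1
      k<p-1 k = ≡.subst (_< p-1) (≡.sym (Finₚ.toℕ-inject₁ k)) (Finₚ.toℕ<n k)

    first≈yᵖ : term zero ≈ y ^ p
    first≈yᵖ = trans (×-homo-1 _) (trans (*-identityˡ _) (sym (^≈^ᴹ y p)))

    last≈xᵖ : term (suc (fromℕ p-1)) ≈ x ^ p
    last≈xᵖ = begin
      term (suc (fromℕ p-1))    ≈⟨ ×-cong (≡.trans (≡.cong (p C_) top≡p) (nCn≡1 p))
                                     (*-cong (Exp.^-congʳ x top≡p)
                                             (Exp.^-congʳ y (≡.trans (≡.cong (p ∸_) top≡p) (ℕₚ.n∸n≡0 p)))) ⟩
      1 · (x ^ᴹ p * 1#)         ≈⟨ ×-homo-1 _ ⟩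
      x ^ᴹ p * 1#               ≈⟨ *-identityʳ _ ⟩
      x ^ᴹ p                    ≈⟨ ^≈^ᴹ x p ⟨
      x ^ p                     ∎
      where
      top≡p : toℕ (suc (fromℕ p-1)) ≡ p
      top≡p = ≡.cong suc (Finₚ.toℕ-fromℕ p-1)

  additive-prime-power : ∀ {p} → Prime p → p · 1# ≈ 0# → ∀ k → Additive (p ℕ.^ k)
  additive-prime-power p-prime p·1≈0 zero    = additive-1
  additive-prime-power {p} p-prime p·1≈0 (suc k) =
    additive-* {p} (additive-prime p-prime p·1≈0) (additive-prime-power p-prime p·1≈0 k)

module FieldProperties {c ℓ : Level} (R : CommutativeRing c ℓ) (R-field : IsField R) where
  open CommutativeRing R hiding (zero)
  open Powers R
  open IntegerCoefficientSolver R
  open import Relation.Binary.Reasoning.Setoid setoid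

  1≉0 : 1# ≉ 0#
  1≉0 = proj₁ R-field

  inverse : ∀ x → x ≉ 0# → Carrier
  inverse x x≉0 = proj₁ (proj₂ R-field x x≉0)

  *-inverseʳ : ∀ x (x≉0 : x ≉ 0#) → x * inverse x x≉0 ≈ 1#
  *-inverseʳ x x≉0 = proj₂ (proj₂ R-field x x≉0)

  *-inverseˡ : ∀ x (x≉0 : x ≉ 0#) → inverse x x≉0 * x ≈ 1#
  *-inverseˡ x x≉0 = trans (*-comm _ _) (*-inverseʳ x x≉0)

  [x*y⁻¹]*y≈x : ∀ x {y} (y≉0 : y ≉ 0#) → (x * inverse y y≉0) * y ≈ x
  [x*y⁻¹]*y≈x x {y} y≉0 = trans (*-assoc _ _ _) (trans (*-congˡ (*-inverseˡ y y≉0)) (*-identityʳ x))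

  *-cancelˡ : ∀ {x y z} → x ≉ 0# → x * y ≈ x * z → y ≈ z
  *-cancelˡ {x} {y} {z} x≉0 xy≈xz = begin
    y                 ≈⟨ *-identityˡ y ⟨
    1# * y            ≈⟨ *-congʳ (*-inverseˡ x x≉0) ⟨
    (x⁻¹ * x) * y     ≈⟨ *-assoc _ _ _ ⟩
    x⁻¹ * (x * y)     ≈⟨ *-congˡ xy≈xz ⟩
    x⁻¹ * (x * z)     ≈⟨ *-assoc _ _ _ ⟨
    (x⁻¹ * x) * z     ≈⟨ *-congʳ (*-inverseˡ x x≉0) ⟩
    1# * z            ≈⟨ *-identityˡ z ⟩
    z                 ∎
    where
    x⁻¹ : Carrier
    x⁻¹ = inverse x x≉0

  *-cancelʳ : ∀ {x y z} → x ≉ 0# → y * x ≈ z * x → y ≈ z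
  *-cancelʳ x≉0 yx≈zx = *-cancelˡ x≉0 (trans (*-comm _ _) (trans yx≈zx (*-comm _ _)))

  x*y≈0⇒x≈0 : ∀ {x y} → y ≉ 0# → x * y ≈ 0# → x ≈ 0#
  x*y≈0⇒x≈0 y≉0 xy≈0 = *-cancelʳ y≉0 (trans xy≈0 (sym (zeroˡ _)))

  *-≉0 : ∀ {x y} → x ≉ 0# → y ≉ 0# → x * y ≉ 0#
  *-≉0 x≉0 y≉0 xy≈0 = x≉0 (x*y≈0⇒x≈0 y≉0 xy≈0)

  ^-≉0 : ∀ {x} n → x ≉ 0# → x ^ n ≉ 0#
  ^-≉0 zero    x≉0 = 1≉0
  ^-≉0 (suc n) x≉0 = *-≉0 x≉0 (^-≉0 n x≉0)

  ^-≈⇒^-∸≈1 : ∀ {x m n} → x ≉ 0# → m ≤ n → x ^ m ≈ x ^ n → x ^ (n ∸ m) ≈ 1#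
  ^-≈⇒^-∸≈1 {x} {m} {n} x≉0 m≤n xᵐ≈xⁿ = sym (*-cancelˡ (^-≉0 m x≉0) (begin
    x ^ m * 1#             ≈⟨ *-identityʳ _ ⟩
    x ^ m                  ≈⟨ xᵐ≈xⁿ ⟩
    x ^ n                  ≈⟨ ^-congʳ x (ℕₚ.m+[n∸m]≡n m≤n) ⟨
    x ^ (m ℕ.+ (n ∸ m))    ≈⟨ ^-homo-* x m (n ∸ m) ⟩
    x ^ m * x ^ (n ∸ m)    ∎))

  ax≈by∧axⁿ⁺¹≈byⁿ⁺¹⇒aⁿ≈bⁿ : ∀ {a b x y} n → b ≉ 0# → y ≉ 0# →
                            a * x ≈ b * y → a * x ^ suc n ≈ b * y ^ suc n → a ^ n ≈ b ^ n
  ax≈by∧axⁿ⁺¹≈byⁿ⁺¹⇒aⁿ≈bⁿ {a} {b} {x} {y} n b≉0 y≉0 ax≈by axⁿ⁺¹≈byⁿ⁺¹ =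
    *-cancelʳ (*-≉0 b≉0 (^-≉0 (suc n) y≉0)) (begin
      a ^ n * (b * y ^ suc n)   ≈⟨ *-congˡ axⁿ⁺¹≈byⁿ⁺¹ ⟨
      a ^ n * (a * x ^ suc n)   ≈⟨ regroup a x ⟩
      (a * x) ^ suc n           ≈⟨ ^-congˡ (suc n) ax≈by ⟩
      (b * y) ^ suc n           ≈⟨ regroup b y ⟨
      b ^ n * (b * y ^ suc n)   ∎)
    where
    regroup : ∀ u v → u ^ n * (u * v ^ suc n) ≈ (u * v) ^ suc n
    regroup u v = begin
      u ^ n * (u * v ^ suc n)   ≈⟨ solve 3 (λ U u V → U :* (u :* V) := (u :* U) :* V) refl (u ^ n) u (v ^ suc n) ⟩
      u ^ suc n * v ^ suc n     ≈⟨ ^-distrib-* u v (suc n) ⟨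
      (u * v) ^ suc n           ∎

module FiniteFieldProperties {c ℓ : Level} (R : CommutativeRing c ℓ) (R-field : IsField R)
                         (n : ℕ) (R-card : HasCard R (suc n)) where
  open CommutativeRing R hiding (zero)
  open Powers R
  open FieldProperties R R-field
  open import Algebra.Properties.Semiring.Mult semiring using (×1-homo-*) renaming (_×_ to _·_)
  open IntegerCoefficientSolver R
  open import Relation.Binary.Reasoning.Setoid setoid

  private
    enum : Fin (suc n) → Carrier
    enum = proj₁ R-card

    enum-injective : ∀ i j → enum i ≈ enum j → i ≡ j
    enum-injective = proj₁ (proj₂ (proj₂ R-card))

    index : Carrier → Fin (suc n)
    index x = proj₁ (proj₂ (proj₂ (proj₂ R-card)) x _)

    enum-index : ∀ x → x ≈ enum (index x)
    enum-index x = proj₂ (proj₂ (proj₂ (proj₂ R-card)) x _)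

  infix 4 _≟_
  _≟_ : Decidable _≈_
  x ≟ y with index x Finₚ.≟ index y
  ... | yes i≡j = yes (trans (enum-index x) (trans (reflexive (≡.cong enum i≡j)) (sym (enum-index y))))
  ... | no  i≢j = no λ x≈y → i≢j (enum-injective _ _ (trans (sym (enum-index x)) (trans x≈y (enum-index y))))

  private
    module _ {a ℓ′} (M : CommutativeMonoid a ℓ′) where
      open CommutativeMonoid M using () renaming (Carrier to A; _≈_ to _≈ᴹ_)
      open CommutativeMonoidSum M using (sum; sum-permute; sum-cong-≋)

      sum-reindex : (h : Carrier → A) → (∀ {x y} → x ≈ y → h x ≈ᴹ h y) →
                    (f g : Carrier → Carrier) → (∀ {x y} → x ≈ y → f x ≈ f y) → (∀ {x y} → x ≈ y → g x ≈ g y) →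
                    (∀ x → f (g x) ≈ x) → (∀ x → g (f x) ≈ x) →
                    sum (λ i → h (enum i)) ≈ᴹ sum (λ i → h (f (enum i)))
      sum-reindex h h-cong f g f-cong g-cong fg≈id gf≈id =
        CommutativeMonoid.trans M (sum-permute (λ i → h (enum i)) (permutation σ τ στ≡id τσ≡id))
                                  (sum-cong-≋ {suc n} (λ i → h-cong (sym (enum-index (f (enum i))))))
        where
        σ τ : Fin (suc n) → Fin (suc n)
        σ i = index (f (enum i))
        τ i = index (g (enum i))
        στ≡id : ∀ i → σ (τ i) ≡ i
        στ≡id i = enum-injective _ _ (trans (sym (enum-index _)) (trans (f-cong (sym (enum-index _))) (fg≈id _)))
        τσ≡id : ∀ i → τ (σ i) ≡ i
        τσ≡id i = enum-injective _ _ (trans (sym (enum-index _)) (trans (g-cong (sym (enum-index _))) (gf≈id _)))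

  card·1≈0 : suc n · 1# ≈ 0#
  card·1≈0 = begin
    suc n · 1#                ≈⟨ solve 2 (λ s t → t := (s :+ t) :- s) refl (sum enum) (suc n · 1#) ⟩
    (sum enum + suc n · 1#) - sum enum ≈⟨ +-congʳ sum+1 ⟨
    sum enum - sum enum       ≈⟨ -‿inverseʳ _ ⟩
    0#                        ∎
    where
    open CommutativeMonoidSum +-commutativeMonoid using (sum; ∑-distrib-+; sum-replicate)
    sum+1 : sum enum ≈ sum enum + suc n · 1#
    sum+1 = begin
      sum enum                              ≈⟨ sum-reindex +-commutativeMonoid (λ x → x) (λ x≈y → x≈y)
                                                 (_+ 1#) (_- 1#) +-congʳ +-congʳ
                                                 (λ x → solve 2 (λ x o → (x :- o) :+ o := x) refl x 1#)
                                                 (λ x → solve 2 (λ x o → (x :+ o) :- o := x) refl x 1#) ⟩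
      sum (λ i → enum i + 1#)               ≈⟨ ∑-distrib-+ enum (λ _ → 1#) ⟩
      sum enum + sum {suc n} (λ _ → 1#)     ≈⟨ +-congˡ (sum-replicate (suc n)) ⟩
      sum enum + suc n · 1#                 ∎

  private
    open CommutativeMonoidSum *-commutativeMonoid using () renaming (sum to product)

    unit : Carrier → Carrier
    unit y with y ≟ 0#
    ... | yes _ = 1#
    ... | no  _ = y

    unit-≉0 : ∀ y → unit y ≉ 0#
    unit-≉0 y with y ≟ 0#
    ... | yes _   = 1≉0
    ... | no  y≉0 = y≉0

    unit-cong : ∀ {y z} → y ≈ z → unit y ≈ unit z
    unit-cong {y} {z} y≈z with y ≟ 0# | z ≟ 0#
    ... | yes _   | yes _   = refl
    ... | yes y≈0 | no  z≉0 = ⊥-elim (z≉0 (trans (sym y≈z) y≈0))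
    ... | no  y≉0 | yes z≈0 = ⊥-elim (y≉0 (trans y≈z z≈0))
    ... | no  _   | no  _   = y≈z

    product-≉0 : ∀ {m} (f : Fin m → Carrier) → (∀ i → f i ≉ 0#) → product f ≉ 0#
    product-≉0 {zero}  f f≉0 = 1≉0
    product-≉0 {suc m} f f≉0 = *-≉0 (f≉0 zero) (product-≉0 (λ i → f (suc i)) (λ i → f≉0 (suc i)))

    module MultiplicationBy {x : Carrier} (x≉0 : x ≉ 0#) where
      open CommutativeMonoidSum *-commutativeMonoid using (sum-cong-≋; sum-remove; sum-replicate)
      open import Algebra.Properties.Semiring.Exp semiring using () renaming (_^_ to _^ᴹ_)

      scale : Carrier → Carrier
      scale y with y ≟ 0#
      ... | yes _ = 1#
      ... | no  _ = x

      unit-* : ∀ y → unit (x * y) ≈ scale y * unit y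
      unit-* y with y ≟ 0# | x * y ≟ 0#
      ... | yes _   | yes _    = sym (*-identityˡ 1#)
      ... | yes y≈0 | no  xy≉0 = ⊥-elim (xy≉0 (trans (*-congˡ y≈0) (zeroʳ x)))
      ... | no  y≉0 | yes xy≈0 = ⊥-elim (*-≉0 x≉0 y≉0 xy≈0)
      ... | no  _   | no  _    = refl

      scale-≈0 : ∀ {y} → y ≈ 0# → scale y ≈ 1#
      scale-≈0 {y} y≈0 with y ≟ 0#
      ... | yes _   = refl
      ... | no  y≉0 = ⊥-elim (y≉0 y≈0)

      scale-≉0 : ∀ {y} → y ≉ 0# → scale y ≈ x
      scale-≉0 {y} y≉0 with y ≟ 0#
      ... | yes y≈0 = ⊥-elim (y≉0 y≈0)
      ... | no  _   = refl

      product-scale : product (λ i → scale (enum i)) ≈ x ^ n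
      product-scale = begin
        product (λ i → scale (enum i))                      ≈⟨ sum-remove {i = zeroIndex} (λ i → scale (enum i)) ⟩
        scale (enum zeroIndex) * product (λ j → scale (enum (punchIn zeroIndex j)))
                                                            ≈⟨ *-cong (scale-≈0 (sym (enum-index 0#)))
                                                                      (sum-cong-≋ {n} (λ j → scale-≉0 (punchIn-≉0 j))) ⟩
        1# * product {n} (λ _ → x)                          ≈⟨ *-identityˡ _ ⟩
        product {n} (λ _ → x)                               ≈⟨ sum-replicate n ⟩
        x ^ᴹ n                                              ≈⟨ ^≈^ᴹ x n ⟨
        x ^ n                                               ∎
        where
        zeroIndex : Fin (suc n)
        zeroIndex = index 0#
        punchIn-≉0 : ∀ j → enum (punchIn zeroIndex j) ≉ 0#
        punchIn-≉0 j e≈0 = Finₚ.punchInᵢ≢i zeroIndex j (enum-injective _ _ (trans e≈0 (enum-index 0#)))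

      x⁻¹ : Carrier
      x⁻¹ = inverse x x≉0

      x*[x⁻¹*y]≈y : ∀ y → x * (x⁻¹ * y) ≈ y
      x*[x⁻¹*y]≈y y = trans (sym (*-assoc _ _ y)) (trans (*-congʳ (*-inverseʳ x x≉0)) (*-identityˡ y))

      x⁻¹*[x*y]≈y : ∀ y → x⁻¹ * (x * y) ≈ y
      x⁻¹*[x*y]≈y y = trans (sym (*-assoc _ _ y)) (trans (*-congʳ (*-inverseˡ x x≉0)) (*-identityˡ y))

  -- Multiplication by x permutes R. `unit` replaces 0 by 1 so that the product over R is
  -- invertible, and `scale` is the factor by which multiplying by x changes `unit`.
  x≉0⇒x^n≈1 : ∀ {x} → x ≉ 0# → x ^ n ≈ 1#
  x≉0⇒x^n≈1 {x} x≉0 = sym (*-cancelʳ (product-≉0 _ (λ i → unit-≉0 (enum i))) (begin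
    1# * product (λ i → unit (enum i))                       ≈⟨ *-identityˡ _ ⟩
    product (λ i → unit (enum i))                            ≈⟨ sum-reindex *-commutativeMonoid unit unit-cong
                                                                  (x *_) (x⁻¹ *_) *-congˡ *-congˡ
                                                                  x*[x⁻¹*y]≈y x⁻¹*[x*y]≈y ⟩
    product (λ i → unit (x * enum i))                        ≈⟨ sum-cong-≋ {suc n} (λ i → unit-* (enum i)) ⟩
    product (λ i → scale (enum i) * unit (enum i))           ≈⟨ ∑-distrib-+ (λ i → scale (enum i))
                                                                               (λ i → unit (enum i)) ⟩
    product (λ i → scale (enum i)) * product (λ i → unit (enum i))
                                                             ≈⟨ *-congʳ product-scale ⟩
    x ^ n * product (λ i → unit (enum i))                    ∎))
    where
    open CommutativeMonoidSum *-commutativeMonoid using (sum-cong-≋; ∑-distrib-+)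
    open MultiplicationBy x≉0

  ^-card : ∀ x → x ^ suc n ≈ x
  ^-card x with x ≟ 0#
  ... | yes x≈0 = trans (*-congʳ x≈0) (trans (zeroˡ _) (sym x≈0))
  ... | no  x≉0 = trans (*-congˡ (x≉0⇒x^n≈1 x≉0)) (*-identityʳ x)

  card≡p^k⇒p·1≈0 : ∀ p → (∃ λ k → suc n ≡ p ℕ.^ k) → p · 1# ≈ 0#
  card≡p^k⇒p·1≈0 p (k , card≡p^k) with p · 1# ≟ 0#
  ... | yes p·1≈0 = p·1≈0
  ... | no  p·1≉0 = ⊥-elim (^-≉0 k p·1≉0 (begin
    (p · 1#) ^ k       ≈⟨ ·1-^ k ⟨
    (p ℕ.^ k) · 1#     ≡⟨ ≡.cong (_· 1#) card≡p^k ⟨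
    suc n · 1#         ≈⟨ card·1≈0 ⟩
    0#                 ∎))
    where
    ·1-^ : ∀ k → (p ℕ.^ k) · 1# ≈ (p · 1#) ^ k
    ·1-^ zero    = +-identityʳ 1#
    ·1-^ (suc k) = trans (×1-homo-* p (p ℕ.^ k)) (*-congˡ (·1-^ k))

module _ {c ℓ : Level} (R : CommutativeRing c ℓ) where
  open CommutativeRing R

  HasSize-image : ∀ {P n} → HasSize R P n → (f : Carrier → Carrier) → (∀ {x y} → x ≈ y → f x ≈ f y) →
                  (∀ {x y} → P x → P y → f x ≈ f y → x ≈ y) →
                  HasSize R (λ y → ∃ λ x → P x × y ≈ f x) n
  HasSize-image (enum , enum∈P , enum-injective , enum-surjective) f f-cong f-injective =
    (λ i → f (enum i)) ,
    (λ i → enum i , enum∈P i , refl) ,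
    (λ i j fi≈fj → enum-injective i j (f-injective (enum∈P i) (enum∈P j) fi≈fj)) ,
    λ { y (x , Px , y≈fx) → let (i , x≈enum-i) = enum-surjective x Px in i , trans y≈fx (f-cong x≈enum-i) }

module FixedField {c ℓ : Level} (L : CommutativeRing c ℓ) (L-field : IsField L)
                  (q-1 r : ℕ) (β : CommutativeRing.Carrier L) where
  open CommutativeRing L hiding (zero)
  open Powers L
  open FieldProperties L L-field
  open IntegerCoefficientSolver L
  open import Algebra.Properties.AbelianGroup +-abelianGroup using (x∙y⁻¹≈ε⇒x≈y)
  open import Relation.Binary.Reasoning.Setoid setoid

  q : ℕ
  q = suc q-1

  open Setup L q r β

  Fq-cong : ∀ {x y} → x ≈ y → Fq x → Fq y
  Fq-cong x≈y (lift x^q≈x) = lift (trans (^-congˡ q (sym x≈y)) (trans x^q≈x x≈y))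

  Fq-0# : Fq 0#
  Fq-0# = lift (zeroˡ _)

  Fq-1# : Fq 1#
  Fq-1# = lift (1^n≈1 q)

  Fq-* : ∀ {x y} → Fq x → Fq y → Fq (x * y)
  Fq-* (lift x^q≈x) (lift y^q≈y) = lift (trans (^-distrib-* _ _ q) (*-cong x^q≈x y^q≈y))

  Fq-^ : ∀ {x} n → Fq x → Fq (x ^ n)
  Fq-^ {x} n (lift x^q≈x) = lift (begin
    (x ^ n) ^ q       ≈⟨ ^-assocʳ x n q ⟩
    x ^ (n ℕ.* q)     ≈⟨ ^-congʳ x (ℕₚ.*-comm n q) ⟩
    x ^ (q ℕ.* n)     ≈⟨ ^-assocʳ x q n ⟨
    (x ^ q) ^ n       ≈⟨ ^-congˡ n x^q≈x ⟩
    x ^ n             ∎)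

  Fq*⇒x^[q-1]≈1 : ∀ {x} → Fq x → x ≉ 0# → x ^ q-1 ≈ 1#
  Fq*⇒x^[q-1]≈1 {x} (lift x^q≈x) x≉0 = *-cancelˡ x≉0 (trans x^q≈x (sym (*-identityʳ x)))

  Fq-- : Additive q → ∀ {x y} → Fq x → Fq y → Fq (x - y)
  Fq-- q-additive (lift x^q≈x) (lift y^q≈y) = lift (trans (additive-sub {q} q-additive _ _) (+-cong x^q≈x (-‿cong y^q≈y)))

  module QuadraticExtension (q-additive : Additive q) (L-card : HasCard L (q ℕ.* q)) (β∉Fq : ¬ Fq β) where
    open FiniteFieldProperties L L-field _ L-card using (_≟_; ^-card)

    ^q-involutive : ∀ x → (x ^ q) ^ q ≈ x
    ^q-involutive x = trans (^-assocʳ x q q) (^-card x)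

    -- φ takes values in the (-1)-eigenspace of x ↦ x^q, so φ x / φ β lies in 𝔽_q.
    private
      φ : Carrier → Carrier
      φ x = x ^ q - x

      φ-anti : ∀ x → φ x ^ q ≈ - φ x
      φ-anti x = begin
        (x ^ q - x) ^ q         ≈⟨ additive-sub {q} q-additive (x ^ q) x ⟩
        (x ^ q) ^ q - x ^ q     ≈⟨ +-congʳ (^q-involutive x) ⟩
        x - x ^ q               ≈⟨ solve 2 (λ x X → x :- X := :- (X :- x)) refl x (x ^ q) ⟩
        - (x ^ q - x)           ∎

      φβ≉0 : φ β ≉ 0#
      φβ≉0 β^q-β≈0 = β∉Fq (lift (x∙y⁻¹≈ε⇒x≈y _ _ β^q-β≈0))

      Fq-ratio : ∀ {u v} (v≉0 : v ≉ 0#) → u ^ q ≈ - u → v ^ q ≈ - v → Fq (u * inverse v v≉0)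
      Fq-ratio {u} {v} v≉0 u^q≈-u v^q≈-v = lift (*-cancelʳ v≉0 (begin
        w ^ q * v               ≈⟨ solve 2 (λ a b → a :* b := :- (a :* (:- b))) refl (w ^ q) v ⟩
        - (w ^ q * - v)         ≈⟨ -‿cong (*-congˡ v^q≈-v) ⟨
        - (w ^ q * v ^ q)       ≈⟨ -‿cong (^-distrib-* w v q) ⟨
        - ((w * v) ^ q)         ≈⟨ -‿cong (^-congˡ q wv≈u) ⟩
        - (u ^ q)               ≈⟨ -‿cong u^q≈-u ⟩
        - - u                   ≈⟨ -‿involutive u ⟩
        u                       ≈⟨ wv≈u ⟨
        w * v                   ∎))
        where
        open import Algebra.Properties.Ring ring using (-‿involutive)
        w : Carrier
        w = u * inverse v v≉0
        wv≈u : w * v ≈ u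
        wv≈u = [x*y⁻¹]*y≈x u v≉0

    Fq-decomposition : ∀ x → ∃ λ a → ∃ λ b → Fq a × Fq b × x ≈ a + b * β
    Fq-decomposition x = a , b , Fq-a , Fq-b , solve 3 (λ x b β → x := (x :- b :* β) :+ b :* β) refl x b β
      where
      b : Carrier
      b = φ x * inverse (φ β) φβ≉0
      Fq-b : Fq b
      Fq-b = Fq-ratio φβ≉0 (φ-anti x) (φ-anti β)
      bφβ≈φx : b * φ β ≈ φ x
      bφβ≈φx = [x*y⁻¹]*y≈x (φ x) φβ≉0
      a : Carrier
      a = x - b * β
      Fq-a : Fq a
      Fq-a = lift (begin
        (x - b * β) ^ q                  ≈⟨ additive-sub {q} q-additive x (b * β) ⟩
        x ^ q - (b * β) ^ q              ≈⟨ +-congˡ (-‿cong (^-distrib-* b β q)) ⟩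
        x ^ q - b ^ q * β ^ q            ≈⟨ +-congˡ (-‿cong (*-congʳ (lower Fq-b))) ⟩
        x ^ q - b * β ^ q                ≈⟨ solve 4 (λ X x b B → X :- b :* B := (X :- x) :+ x :- b :* B)
                                              refl (x ^ q) x b (β ^ q) ⟩
        φ x + x - b * β ^ q     ≈⟨ +-congʳ (+-congʳ bφβ≈φx) ⟨
        b * (β ^ q - β) + x - b * β ^ q  ≈⟨ solve 4 (λ b B β x → b :* (B :- β) :+ x :- b :* B := x :- b :* β)
                                              refl b (β ^ q) β x ⟩
        x - b * β                        ∎)

    Fq-*β∈Fq⇒≈0 : ∀ {u} → Fq u → Fq (u * β) → u ≈ 0#
    Fq-*β∈Fq⇒≈0 {u} (lift u^q≈u) (lift [uβ]^q≈uβ) = x*y≈0⇒x≈0 φβ≉0 (begin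
      u * (β ^ q - β)              ≈⟨ solve 3 (λ u B β → u :* (B :- β) := u :* B :- u :* β) refl u (β ^ q) β ⟩
      u * β ^ q - u * β            ≈⟨ +-congʳ (*-congʳ u^q≈u) ⟨
      u ^ q * β ^ q - u * β        ≈⟨ +-congʳ (^-distrib-* u β q) ⟨
      (u * β) ^ q - u * β          ≈⟨ +-congʳ [uβ]^q≈uβ ⟩
      u * β - u * β                ≈⟨ -‿inverseʳ _ ⟩
      0#                           ∎)

    Fq-coordinates-unique : ∀ {a b a′ b′} → Fq a → Fq b → Fq a′ → Fq b′ →
                            a + b * β ≈ a′ + b′ * β → a ≈ a′ × b ≈ b′
    Fq-coordinates-unique {a} {b} {a′} {b′} Fq-a Fq-b Fq-a′ Fq-b′ eq = a≈a′ , b≈b′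
      where
      [b-b′]β≈a′-a : (b - b′) * β ≈ a′ - a
      [b-b′]β≈a′-a = begin
        (b - b′) * β                  ≈⟨ solve 4 (λ a b b′ β → (b :- b′) :* β := ((a :+ b :* β) :- a) :- b′ :* β)
                                           refl a b b′ β ⟩
        ((a + b * β) - a) - b′ * β    ≈⟨ +-congʳ (+-congʳ eq) ⟩
        ((a′ + b′ * β) - a) - b′ * β  ≈⟨ solve 4 (λ a a′ b′ β → ((a′ :+ b′ :* β) :- a) :- b′ :* β := a′ :- a)
                                           refl a a′ b′ β ⟩
        a′ - a                        ∎
      Fq-[b-b′]β : Fq ((b - b′) * β)
      Fq-[b-b′]β = Fq-cong (sym [b-b′]β≈a′-a) (Fq-- q-additive Fq-a′ Fq-a)
      b≈b′ : b ≈ b′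
      b≈b′ = x∙y⁻¹≈ε⇒x≈y _ _ (Fq-*β∈Fq⇒≈0 (Fq-- q-additive Fq-b Fq-b′) Fq-[b-b′]β)
      a≈a′ : a ≈ a′
      a≈a′ = begin
        a                       ≈⟨ solve 3 (λ a b β → a := (a :+ b :* β) :- b :* β) refl a b β ⟩
        (a + b * β) - b * β     ≈⟨ +-cong eq (-‿cong (*-congʳ b≈b′)) ⟩
        (a′ + b′ * β) - b′ * β  ≈⟨ solve 3 (λ a b β → (a :+ b :* β) :- b :* β := a) refl a′ b′ β ⟩
        a′                      ∎

    module PrimitiveElement (ε : Carrier) (ε-primitive : IsPrimitive ε) where

      Fq-ε : Fq ε
      Fq-ε = proj₁ (proj₁ ε-primitive)

      ε≉0 : ε ≉ 0#
      ε≉0 = proj₂ (proj₁ ε-primitive)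

      zeroOrPower : (k : ℕ) → Fin (suc k) → Carrier
      zeroOrPower k zero    = 0#
      zeroOrPower k (suc j) = ε ^ toℕ j

      zeroOrPower-surjective : ∀ k .{{_ : NonZero k}} → ε ^ k ≈ 1# → ∀ x → Fq x → ∃ λ j → x ≈ zeroOrPower k j
      zeroOrPower-surjective k εᵏ≈1 x Fq-x with x ≟ 0#
      ... | yes x≈0 = zero , x≈0
      ... | no  x≉0 = let (m , x≈εᵐ) = proj₂ ε-primitive x (Fq-x , x≉0) in
        suc (fromℕ< (m%n<n m k)) ,
        trans x≈εᵐ (trans (^-reduce-% k εᵏ≈1 m) (^-congʳ ε (≡.sym (Finₚ.toℕ-fromℕ< (m%n<n m k)))))

      -- If εᵏ ≈ 1 then 𝔽_q ⊆ {0, ε⁰, …, εᵏ⁻¹}, and coordinates would inject L into pairs of these.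
      primitive-^-≉1 : ∀ k .{{_ : NonZero k}} → k < q-1 → ε ^ k ≉ 1#
      primitive-^-≉1 k k<q-1 εᵏ≈1 =
        ℕₚ.<⇒≱ (ℕₚ.*-mono-< (s≤s k<q-1) (s≤s k<q-1)) (Finₚ.injective⇒≤ {f = encode} encode-injective)
        where
        enum : Fin (q ℕ.* q) → Carrier
        enum = proj₁ L-card

        value : Fin (suc k) × Fin (suc k) → Carrier
        value (i , j) = zeroOrPower k i + zeroOrPower k j * β

        coordinates : ∀ x → Σ (Fin (suc k) × Fin (suc k)) λ ij → x ≈ value ij
        coordinates x =
          let (a , b , Fq-a , Fq-b , x≈a+bβ) = Fq-decomposition x
              (i , a≈) = zeroOrPower-surjective k εᵏ≈1 a Fq-a
              (j , b≈) = zeroOrPower-surjective k εᵏ≈1 b Fq-b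
          in (i , j) , trans x≈a+bβ (+-cong a≈ (*-congʳ b≈))

        encode : Fin (q ℕ.* q) → Fin (suc k ℕ.* suc k)
        encode n = uncurry combine (proj₁ (coordinates (enum n)))

        encode-injective : ∀ {m n} → encode m ≡ encode n → m ≡ n
        encode-injective {m} {n} eq = proj₁ (proj₂ (proj₂ L-card)) m n (begin
          enum m           ≈⟨ proj₂ (coordinates (enum m)) ⟩
          value ijₘ        ≡⟨ ≡.cong value ijₘ≡ijₙ ⟩
          value ijₙ        ≈⟨ proj₂ (coordinates (enum n)) ⟨
          enum n           ∎)
          where
          ijₘ ijₙ : Fin (suc k) × Fin (suc k)
          ijₘ = proj₁ (coordinates (enum m))
          ijₙ = proj₁ (coordinates (enum n))
          ijₘ≡ijₙ : ijₘ ≡ ijₙ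
          ijₘ≡ijₙ = ×-≡,≡→≡ (Finₚ.combine-injective (proj₁ ijₘ) (proj₂ ijₘ) (proj₁ ijₙ) (proj₂ ijₙ) eq)

      primitive-^-≉^ : ∀ {m n} → m < n → n < q-1 → ε ^ m ≉ ε ^ n
      primitive-^-≉^ {m} {n} m<n n<q-1 εᵐ≈εⁿ =
        primitive-^-≉1 (n ∸ m) {{ℕ.>-nonZero (ℕₚ.m<n⇒0<n∸m m<n)}} (ℕₚ.≤-<-trans (ℕₚ.m∸n≤m n m) n<q-1)
                       (^-≈⇒^-∸≈1 ε≉0 (ℕₚ.<⇒≤ m<n) εᵐ≈εⁿ)

      primitive-^-injective : ∀ {m n} → m < q-1 → n < q-1 → ε ^ m ≈ ε ^ n → m ≡ n
      primitive-^-injective {m} {n} m<q-1 n<q-1 εᵐ≈εⁿ with ℕₚ.<-cmp m n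
      ... | tri< m<n _ _ = ⊥-elim (primitive-^-≉^ m<n n<q-1 εᵐ≈εⁿ)
      ... | tri≈ _ m≡n _ = m≡n
      ... | tri> _ _ n<m = ⊥-elim (primitive-^-≉^ n<m m<q-1 (sym εᵐ≈εⁿ))

      Fq-size : .{{_ : NonZero q-1}} → HasSize L Fq q
      Fq-size = zeroOrPower q-1 , zeroOrPower-∈Fq , zeroOrPower-injective ,
                zeroOrPower-surjective q-1 (Fq*⇒x^[q-1]≈1 Fq-ε ε≉0)
        where
        zeroOrPower-∈Fq : ∀ j → Fq (zeroOrPower q-1 j)
        zeroOrPower-∈Fq zero    = Fq-0#
        zeroOrPower-∈Fq (suc j) = Fq-^ (toℕ j) Fq-ε

        zeroOrPower-injective : ∀ i j → zeroOrPower q-1 i ≈ zeroOrPower q-1 j → i ≡ j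
        zeroOrPower-injective zero    zero    _     = ≡.refl
        zeroOrPower-injective zero    (suc j) 0≈εʲ  = ⊥-elim (^-≉0 (toℕ j) ε≉0 (sym 0≈εʲ))
        zeroOrPower-injective (suc i) zero    εⁱ≈0  = ⊥-elim (^-≉0 (toℕ i) ε≉0 εⁱ≈0)
        zeroOrPower-injective (suc i) (suc j) εⁱ≈εʲ =
          ≡.cong suc (Finₚ.toℕ-injective (primitive-^-injective (Finₚ.toℕ<n i) (Finₚ.toℕ<n j) εⁱ≈εʲ))

-- √q = r is written s + 2, so that r, r - 1, q and q - 1 all reduce to successors.
module EpsCq (s : ℕ) where

  r-1 r q-1 q : ℕ
  r-1 = suc s
  r   = suc r-1
  q-1 = r-1 ℕ.+ r-1 ℕ.* r
  q   = r ℕ.* r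

  r-1*[r+1]≡q-1 : r-1 ℕ.* suc r ≡ q-1
  r-1*[r+1]≡q-1 = ℕₚ.*-suc r-1 r

  r-1<q-1 : r-1 < q-1
  r-1<q-1 = ℕₚ.m<m+n r-1 ℕ.z<s

  i*[r-1]<q-1 : ∀ {i} → i ≤ r → i ℕ.* r-1 < q-1
  i*[r-1]<q-1 {i} i≤r = ℕₚ.≤-<-trans (ℕₚ.≤-trans (ℕₚ.*-monoˡ-≤ r-1 i≤r) (ℕₚ.≤-reflexive (ℕₚ.*-comm r r-1)))
                                    (ℕₚ.m<n+m (r-1 ℕ.* r) ℕ.z<s)

  module Properties {c ℓ : Level} (L : CommutativeRing c ℓ) (L-field : IsField L)
                    (L-card : HasCard L (q ℕ.* q)) (r-additive : Powers.Additive L r)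
                    (β ε : CommutativeRing.Carrier L)
                    (β∉Fq : ¬ Setup.Fq L q r β β) (ε-primitive : Setup.IsPrimitive L q r β ε) where
    open CommutativeRing L hiding (zero)
    open Powers L
    open FieldProperties L L-field
    open IntegerCoefficientSolver L
    open import Algebra.Properties.AbelianGroup +-abelianGroup using (x∙y⁻¹≈ε⇒x≈y)
    open import Algebra.Properties.Ring ring using (-0#≈0#)
    open import Relation.Binary.Reasoning.Setoid setoid
    open Setup L q r β
    open FixedField L L-field q-1 r β hiding (q)

    q-additive : Additive q
    q-additive = additive-* {r} {r} r-additive r-additive

    open QuadraticExtension q-additive L-card β∉Fq
    open PrimitiveElement ε ε-primitive
    open FiniteFieldProperties L L-field _ L-card using (_≟_)

    point : ℕ → Carrier → Carrier
    point i γ = ε ^ i * (γ ^ r + γ * β)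

    point-cong : ∀ i {γ η} → γ ≈ η → point i γ ≈ point i η
    point-cong i γ≈η = *-congˡ (+-cong (^-congˡ r γ≈η) (*-congʳ γ≈η))

    point-0# : ∀ i → point i 0# ≈ 0#
    point-0# i = trans (*-congˡ (trans (+-cong (zeroˡ _) (zeroˡ β)) (+-identityˡ 0#))) (zeroʳ _)

    ≈0⇒∈epsCq : ∀ i {y} → y ≈ 0# → epsCq ε i y
    ≈0⇒∈epsCq i y≈0 = 0# , Fq-0# , trans y≈0 (sym (point-0# i))

    point-coordinates : ∀ i j {γ η} → Fq γ → Fq η → point i γ ≈ point j η →
                        ε ^ i * γ ^ r ≈ ε ^ j * η ^ r × ε ^ i * γ ≈ ε ^ j * η
    point-coordinates i j {γ} {η} Fq-γ Fq-η pᵢγ≈pⱼη =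
      Fq-coordinates-unique (Fq-* (Fq-^ i Fq-ε) (Fq-^ r Fq-γ)) (Fq-* (Fq-^ i Fq-ε) Fq-γ)
                            (Fq-* (Fq-^ j Fq-ε) (Fq-^ r Fq-η)) (Fq-* (Fq-^ j Fq-ε) Fq-η)
                            (trans (sym (expand i γ)) (trans pᵢγ≈pⱼη (expand j η)))
      where
      expand : ∀ i γ → point i γ ≈ ε ^ i * γ ^ r + (ε ^ i * γ) * β
      expand i γ = solve 4 (λ e g G b → e :* (G :+ g :* b) := e :* G :+ (e :* g) :* b) refl (ε ^ i) γ (γ ^ r) β

    epsCq-size : ∀ i → HasSize L (epsCq ε i) q
    epsCq-size i = HasSize-image L Fq-size (point i) (point-cong i)
      λ Fq-γ Fq-η pᵢγ≈pᵢη → *-cancelˡ (^-≉0 i ε≉0) (proj₂ (point-coordinates i i Fq-γ Fq-η pᵢγ≈pᵢη))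

    Fq*⇒x^[r-1]∈Q : ∀ {x} → Fq x → x ≉ 0# → Qset (x ^ r-1)
    Fq*⇒x^[r-1]∈Q {x} Fq-x x≉0 = (Fq-^ r-1 Fq-x , ^-≉0 r-1 x≉0) , (begin
      (x ^ r-1) ^ suc r    ≈⟨ ^-assocʳ x r-1 (suc r) ⟩
      x ^ (r-1 ℕ.* suc r)  ≡⟨ ≡.cong (x ^_) r-1*[r+1]≡q-1 ⟩
      x ^ q-1              ≈⟨ Fq*⇒x^[q-1]≈1 Fq-x x≉0 ⟩
      1#                   ∎)

    point-difference : ∀ i γ₁ γ₂ → point i γ₁ - point i γ₂ ≈ ((γ₁ - γ₂) ^ r-1 + β) * (ε ^ i * (γ₁ - γ₂))
    point-difference i γ₁ γ₂ = begin
      point i γ₁ - point i γ₂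
        ≈⟨ solve 6 (λ e a b A B β → e :* (A :+ a :* β) :- e :* (B :+ b :* β) := e :* ((A :- B) :+ (a :- b) :* β))
             refl (ε ^ i) γ₁ γ₂ (γ₁ ^ r) (γ₂ ^ r) β ⟩
      ε ^ i * ((γ₁ ^ r - γ₂ ^ r) + γ * β)  ≈⟨ *-congˡ (+-congʳ (additive-sub {r} r-additive γ₁ γ₂)) ⟨
      ε ^ i * (γ * γ ^ r-1 + γ * β)        ≈⟨ solve 4 (λ e g d b → e :* (g :* d :+ g :* b) := (d :+ b) :* (e :* g))
                                                refl (ε ^ i) γ (γ ^ r-1) β ⟩
      (γ ^ r-1 + β) * (ε ^ i * γ)          ∎
      where
      γ : Carrier
      γ = γ₁ - γ₂

    epsCq-clique : ∀ i → IsClique L Xadj (epsCq ε i)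
    epsCq-clique i g h (γ₁ , Fq-γ₁ , g≈pᵢγ₁) (γ₂ , Fq-γ₂ , h≈pᵢγ₂) g≉h =
      γ ^ r-1 , ε ^ i * γ , Fq*⇒x^[r-1]∈Q Fq-γ γ≉0 ,
      (Fq-* (Fq-^ i Fq-ε) Fq-γ , *-≉0 (^-≉0 i ε≉0) γ≉0) ,
      trans (+-cong g≈pᵢγ₁ (-‿cong h≈pᵢγ₂)) (point-difference i γ₁ γ₂)
      where
      γ : Carrier
      γ = γ₁ - γ₂
      Fq-γ : Fq γ
      Fq-γ = Fq-- q-additive Fq-γ₁ Fq-γ₂
      γ≉0 : γ ≉ 0#
      γ≉0 γ≈0 = g≉h (trans g≈pᵢγ₁ (trans (point-cong i (x∙y⁻¹≈ε⇒x≈y γ₁ γ₂ γ≈0)) (sym h≈pᵢγ₂)))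

    -- With 0 = x + (δ + β)t₀ and εⁱ(γ^r + γβ) = x + (δ + β)t, the coordinates of the difference give
    -- εⁱγ = t - t₀ and εⁱγ^r = δ(t - t₀).
    canonical⇒^r-linear : ∀ i → IsCanonical (epsCq ε i) → ∃ λ δ → ∀ γ → Fq γ → γ ^ r ≈ δ * γ
    canonical⇒^r-linear i (x , δ , ((Fq-δ , _) , _) , C≡x+⟨δ+β⟩Fq) = δ , ^r-linear
      where
      on-line : ∀ {y} → epsCq ε i y → ∃ λ t → Fq t × y ≈ x + (δ + β) * t
      on-line {y} = proj₁ (C≡x+⟨δ+β⟩Fq y)

      ^r-linear : ∀ γ → Fq γ → γ ^ r ≈ δ * γ
      ^r-linear γ Fq-γ = *-cancelˡ (^-≉0 i ε≉0) (begin
        ε ^ i * γ ^ r     ≈⟨ proj₁ coordinates ⟩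
        δ * (t - t₀)      ≈⟨ *-congˡ (proj₂ coordinates) ⟨
        δ * (ε ^ i * γ)   ≈⟨ solve 3 (λ d e g → d :* (e :* g) := e :* (d :* g)) refl δ (ε ^ i) γ ⟩
        ε ^ i * (δ * γ)   ∎)
        where
        line₀ : ∃ λ t₀ → Fq t₀ × 0# ≈ x + (δ + β) * t₀
        line₀ = on-line (≈0⇒∈epsCq i refl)
        line : ∃ λ t → Fq t × point i γ ≈ x + (δ + β) * t
        line = on-line (γ , Fq-γ , refl)
        t₀ t : Carrier
        t₀ = proj₁ line₀
        t  = proj₁ line
        Fq-[t-t₀] : Fq (t - t₀)
        Fq-[t-t₀] = Fq-- q-additive (proj₁ (proj₂ line)) (proj₁ (proj₂ line₀))
        difference : ε ^ i * γ ^ r + (ε ^ i * γ) * β ≈ δ * (t - t₀) + (t - t₀) * β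
        difference = begin
          ε ^ i * γ ^ r + (ε ^ i * γ) * β
            ≈⟨ solve 4 (λ e g G b → e :* G :+ (e :* g) :* b := e :* (G :+ g :* b)) refl (ε ^ i) γ (γ ^ r) β ⟩
          point i γ
            ≈⟨ trans (+-congˡ -0#≈0#) (+-identityʳ _) ⟨
          point i γ - 0#
            ≈⟨ +-cong (proj₂ (proj₂ line)) (-‿cong (proj₂ (proj₂ line₀))) ⟩
          (x + (δ + β) * t) - (x + (δ + β) * t₀)
            ≈⟨ solve 5 (λ x d b t u → (x :+ (d :+ b) :* t) :- (x :+ (d :+ b) :* u) := d :* (t :- u) :+ (t :- u) :* b)
                 refl x δ β t t₀ ⟩
          δ * (t - t₀) + (t - t₀) * β ∎
        coordinates : ε ^ i * γ ^ r ≈ δ * (t - t₀) × ε ^ i * γ ≈ t - t₀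
        coordinates = Fq-coordinates-unique (Fq-* (Fq-^ i Fq-ε) (Fq-^ r Fq-γ)) (Fq-* (Fq-^ i Fq-ε) Fq-γ)
                                            (Fq-* Fq-δ Fq-[t-t₀]) Fq-[t-t₀] difference

    ¬^r-linear : ∀ δ → ¬ (∀ γ → Fq γ → γ ^ r ≈ δ * γ)
    ¬^r-linear δ ^r-linear = ℕₚ.1+n≢0 (primitive-^-injective r-1<q-1 ℕ.z<s εʳ⁻¹≈1)
      where
      δ≈1 : δ ≈ 1#
      δ≈1 = begin
        δ          ≈⟨ *-identityʳ δ ⟨
        δ * 1#     ≈⟨ ^r-linear 1# Fq-1# ⟨
        1# ^ r     ≈⟨ 1^n≈1 r ⟩
        1#         ∎
      εʳ⁻¹≈1 : ε ^ r-1 ≈ 1#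
      εʳ⁻¹≈1 = *-cancelˡ ε≉0 (begin
        ε ^ r      ≈⟨ ^r-linear ε Fq-ε ⟩
        δ * ε      ≈⟨ *-congʳ δ≈1 ⟩
        1# * ε     ≈⟨ *-comm 1# ε ⟩
        ε * 1#     ∎)

    epsCq-nonCanonical : ∀ i → ¬ IsCanonical (epsCq ε i)
    epsCq-nonCanonical i canonical = let (δ , ^r-linear) = canonical⇒^r-linear i canonical in ¬^r-linear δ ^r-linear

    epsCq-nonCanonicalClique : ∀ i → IsNonCanonicalClique (epsCq ε i)
    epsCq-nonCanonicalClique i = (epsCq-clique i , epsCq-size i) , epsCq-nonCanonical i

    epsCq∩epsCq⊆0 : ∀ {i j} → i ≤ r → j ≤ r → i ≢ j → ∀ {y} → epsCq ε i y → epsCq ε j y → y ≈ 0#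
    epsCq∩epsCq⊆0 {i} {j} i≤r j≤r i≢j {y} (γ , Fq-γ , y≈pᵢγ) (η , Fq-η , y≈pⱼη) with γ ≟ 0#
    ... | yes γ≈0 = trans y≈pᵢγ (trans (point-cong i γ≈0) (point-0# i))
    ... | no  γ≉0 = ⊥-elim (i≢j (ℕₚ.*-cancelʳ-≡ i j r-1 i[r-1]≡j[r-1]))
      where
      coordinates : ε ^ i * γ ^ r ≈ ε ^ j * η ^ r × ε ^ i * γ ≈ ε ^ j * η
      coordinates = point-coordinates i j Fq-γ Fq-η (trans (sym y≈pᵢγ) y≈pⱼη)
      η≉0 : η ≉ 0#
      η≉0 η≈0 = *-≉0 (^-≉0 i ε≉0) γ≉0 (trans (proj₂ coordinates) (trans (*-congˡ η≈0) (zeroʳ _)))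
      εⁱ⁽ʳ⁻¹⁾≈εʲ⁽ʳ⁻¹⁾ : ε ^ (i ℕ.* r-1) ≈ ε ^ (j ℕ.* r-1)
      εⁱ⁽ʳ⁻¹⁾≈εʲ⁽ʳ⁻¹⁾ = begin
        ε ^ (i ℕ.* r-1)    ≈⟨ ^-assocʳ ε i r-1 ⟨
        (ε ^ i) ^ r-1      ≈⟨ ax≈by∧axⁿ⁺¹≈byⁿ⁺¹⇒aⁿ≈bⁿ r-1 (^-≉0 j ε≉0) η≉0 (proj₂ coordinates) (proj₁ coordinates) ⟩
        (ε ^ j) ^ r-1      ≈⟨ ^-assocʳ ε j r-1 ⟩
        ε ^ (j ℕ.* r-1)    ∎
      i[r-1]≡j[r-1] : i ℕ.* r-1 ≡ j ℕ.* r-1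
      i[r-1]≡j[r-1] = primitive-^-injective (i*[r-1]<q-1 i≤r) (i*[r-1]<q-1 j≤r) εⁱ⁽ʳ⁻¹⁾≈εʲ⁽ʳ⁻¹⁾

open import Data.Nat using (_*_)

prime-power≡2+ : ∀ {p m n} → Prime p → 1 ≤ m → n ≡ p ℕ.^ m → ∃ λ s → n ≡ suc (suc s)
prime-power≡2+ {p} {suc m} {n} p-prime _ n≡p^[1+m] = n ∸ 2 , ≡.sym (ℕₚ.m+[n∸m]≡n 2≤n)
  where
  instance
    _ = prime⇒nonZero p-prime
    _ = prime⇒nonTrivial p-prime
    _ = ℕₚ.m^n≢0 p m
  2≤n : 2 ≤ n
  2≤n = ≡.subst (2 ≤_) (≡.sym n≡p^[1+m]) (ℕₚ.≤-trans (ℕ.nonTrivial⇒n>1 p) (ℕₚ.m≤m*n p (p ℕ.^ m)))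

[r*r]*[r*r]≡p^k : ∀ {r} p m → r ≡ p ℕ.^ m → ∃ λ k → (r * r) * (r * r) ≡ p ℕ.^ k
[r*r]*[r*r]≡p^k p m ≡.refl = (m ℕ.+ m) ℕ.+ (m ℕ.+ m) ,
  ≡.sym (≡.trans (ℕₚ.^-distribˡ-+-* p (m ℕ.+ m) (m ℕ.+ m))
                 (≡.cong₂ _*_ (ℕₚ.^-distribˡ-+-* p m m) (ℕₚ.^-distribˡ-+-* p m m)))

corollary7p2 : {c ℓ : Level} (L : CommutativeRing c ℓ) (q r : ℕ)
    → IsSqPrimePower q r
    → IsField L
    → HasCard L (q * q)
    → (β ε : CommutativeRing.Carrier L)
    → ¬ Setup.Fq L q r β β
    → Setup.IsPrimitive L q r β ε
    → ((i : ℕ) → i ≤ r → Setup.IsNonCanonicalClique L q r β (Setup.epsCq L q r β ε i))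
      × ((i j : ℕ) → i ≤ r → j ≤ r → ¬ (i ≡ j) → (y : CommutativeRing.Carrier L)
          → ((Setup.epsCq L q r β ε i y × Setup.epsCq L q r β ε j y) → CommutativeRing._≈_ L y (CommutativeRing.0# L))
          × (CommutativeRing._≈_ L y (CommutativeRing.0# L) → (Setup.epsCq L q r β ε i y × Setup.epsCq L q r β ε j y)))
corollary7p2 L q r (p , m , p-prime , 1≤m , r≡p^m , ≡.refl) L-field L-card β ε β∉Fq ε-primitive
  with prime-power≡2+ p-prime 1≤m r≡p^m
... | s , ≡.refl =
  (λ i _ → epsCq-nonCanonicalClique i) ,
  λ i j i≤r j≤r i≢j y →
    (λ (yᵢ , yⱼ) → epsCq∩epsCq⊆0 i≤r j≤r i≢j yᵢ yⱼ) ,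
    (λ y≈0 → ≈0⇒∈epsCq i y≈0 , ≈0⇒∈epsCq j y≈0)
  where
  open FiniteFieldProperties L L-field _ L-card using (card≡p^k⇒p·1≈0)
  r-additive : Powers.Additive L r
  r-additive = ≡.subst (Powers.Additive L) (≡.sym r≡p^m)
    (Powers.additive-prime-power L p-prime (card≡p^k⇒p·1≈0 p ([r*r]*[r*r]≡p^k p m r≡p^m)) m)
  open EpsCq.Properties s L L-field L-card r-additive β ε β∉Fq ε-primitive
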